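{- Let $n\geq 1$ and let $G$ be a digraph on $4n$ vertices that is a vertex-disjoint union of directed cycles, each of length at least $2$. Then $G$ has a balanced $H_4$-coloring.
   Context: $H_4$ is the digraph with vertex set $\{0,1,2,3\}$ and arcs $i\to i+1 \pmod 4$ and $i\to i+2\pmod 4$ for each $i$ (i.e. arcs $0\to1,0\to2,1\to2,1\to3,2\to3,2\to0,3\to0,3\to1$). An $H_4$-coloring of a digraph $G$ is a map $\phi:V(G)\to\{0,1,2,3\}$ such that $\phi(u)\to\phi(v)$ is an arc of $H_4$ for every arc $u\to v$ of $G$; it is balanced if all four color classes $\phi^{ -1}(c)$ have the same size. -}

module Defs where

open import Data.Nat using (ℕ)
open import Data.Fin using (Fin; zero; suc)
open import Data.Fin.Properties using (_≟_)
open import Data.Fin.Permutation using (Permutation′; _⟨$⟩ʳ_)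
open import Data.List using (List; length; filter; allFin)
open import Data.Product using (Σ; _×_)
open import Relation.Binary.PropositionalEquality using (_≡_; _≢_)
open import Function.Bundles using (_⇔_)


Digraph : ℕ → Set₁
Digraph N = Fin N → Fin N → Set

data H4Arc : Fin 4 → Fin 4 → Set where
  a01 : H4Arc zero (suc zero)
  a02 : H4Arc zero (suc (suc zero))
  a12 : H4Arc (suc zero) (suc (suc zero))
  a13 : H4Arc (suc zero) (suc (suc (suc zero)))
  a23 : H4Arc (suc (suc zero)) (suc (suc (suc zero)))
  a20 : H4Arc (suc (suc zero)) zero
  a30 : H4Arc (suc (suc (suc zero))) zero
  a31 : H4Arc (suc (suc (suc zero))) (suc zero)

-- G is a vertex-disjoint union of directed cycles (covering all vertices),
-- each of length ≥ 2: there is a permutation σ of the vertices (the cycles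
-- are its orbits) with no fixed points, and the arcs of G are exactly u → σ u.
IsUnionOfCycles≥2 : {N : ℕ} → Digraph N → Set
IsUnionOfCycles≥2 {N} G =
  Σ (Permutation′ N) λ σ →
    (∀ v → σ ⟨$⟩ʳ v ≢ v) ×
    (∀ u v → G u v ⇔ (v ≡ σ ⟨$⟩ʳ u))

IsH4Coloring : {N : ℕ} → Digraph N → (Fin N → Fin 4) → Set
IsH4Coloring G φ = ∀ u v → G u v → H4Arc (φ u) (φ v)

classSize : {N : ℕ} → (Fin N → Fin 4) → Fin 4 → ℕ
classSize {N} φ c = length (filter (λ v → φ v ≟ c) (allFin N))

IsBalanced : {N : ℕ} → (Fin N → Fin 4) → Set
IsBalanced φ = ∀ c d → classSize φ c ≡ classSize φ d

-- A colouring of a directed cycle of length L is a closed walk of length L in H₄: a cyclic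
-- sequence of steps +1 and +2 (mod 4) adding up to 0 mod 4. For L = 4q + r ≥ 2 there is such a walk
-- visiting every colour q times plus an excess that depends only on r and on a freely chosen
-- rotation p, namely ∅, {p}, {p, p+2} or {p, p+1, p+2} (a 2-cycle forces two opposite colours).
-- Two excesses of this shape can always be rotated against each other so that their sum is again
-- of this shape plus some full rounds of all four colours. Colouring the cycles one at a time while
-- keeping the accumulated excess of this shape, its size at the end is 4n mod 4 = 0, so every
-- colour class has the same size.
module Submission where

open import Defs
open import Data.Bool using (Bool; true; false; _∧_; _∨_; not; if_then_else_)
import Data.Bool.Properties as Bool
open import Data.Fin using (Fin; zero; suc; toℕ)
open import Data.Fin.Patterns using (0F; 1F; 2F; 3F)
open import Data.Fin.Permutation using (_⟨$⟩ʳ_)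
open import Data.Fin.Properties using (_≟_; all?; any?; pigeonhole; toℕ-fromℕ<; toℕ-injective; toℕ<n)
open import Data.List using (length; filter; tabulate)
open import Data.Nat using (ℕ; zero; suc; _+_; _*_; _∸_; _<_; _≤_; _≥_; z≤n; s≤s; NonZero; _%_; _/_)
open import Data.Nat.DivMod using (_mod_; m≡m%n+[m/n]*n; m<n⇒m%n≡m; [m+kn]%n≡m%n; m*n%n≡0)
open import Data.Nat.Induction using (<-rec; <-wellFounded)
import Data.Nat.Properties as ℕ
open import Algebra.Properties.CommutativeSemigroup ℕ.+-commutativeSemigroup
  using () renaming (x∙yz≈y∙xz to +-left-comm; xy∙z≈xz∙y to +-right-comm; interchange to +-interchange)
open import Algebra.Properties.CommutativeMonoid.Sum ℕ.+-0-commutativeMonoid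
  using (sum-syntax; ∑-distrib-+; sum-cong-≗; sum-replicate-zero)
open import Data.Product using (Σ; ∃; ∃₂; _×_; _,_; proj₁; proj₂)
open import Data.Sum using (inj₁; inj₂)
open import Function.Base using (id)
open import Function.Bundles using (Equivalence; Injection)
open import Function.Definitions using (Injective)
open import Function.Properties.Inverse using (↔⇒↣)
open import Induction.WellFounded using (Acc; acc)
open import Relation.Binary.Definitions using (tri<; tri≈; tri>)
open import Relation.Binary.PropositionalEquality
  using (_≡_; _≢_; refl; sym; trans; cong; cong₂; subst; subst₂; module ≡-Reasoning)
open import Relation.Nullary using (¬_; yes; no; does; contradiction)
open import Relation.Nullary.Decidable using (from-yes; dec-true; dec-false)
open import Relation.Unary using (Decidable)

𝟙 : Bool → ℕ
𝟙 b = if b then 1 else 0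

δ : Fin 4 → Fin 4 → ℕ
δ c d = 𝟙 (does (c ≟ d))

∑< : ℕ → (ℕ → ℕ) → ℕ
∑< zero    f = 0
∑< (suc n) f = ∑< n f + f n

∑<-cong : ∀ n {f g : ℕ → ℕ} → (∀ i → i < n → f i ≡ g i) → ∑< n f ≡ ∑< n g
∑<-cong zero    eq = refl
∑<-cong (suc n) eq = cong₂ _+_ (∑<-cong n λ i i<n → eq i (ℕ.m<n⇒m<1+n i<n)) (eq n (ℕ.n<1+n n))

∑<-+ : ∀ m n f → ∑< (m + n) f ≡ ∑< m f + ∑< n (λ i → f (m + i))
∑<-+ m zero    f = trans (cong (λ k → ∑< k f) (ℕ.+-identityʳ m)) (sym (ℕ.+-identityʳ _))
∑<-+ m (suc n) f rewrite ℕ.+-suc m n =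
  trans (cong (_+ f (m + n)) (∑<-+ m n f)) (ℕ.+-assoc (∑< m f) _ (f (m + n)))

∑<-1 : ∀ n → ∑< n (λ _ → 1) ≡ n
∑<-1 zero    = refl
∑<-1 (suc n) = trans (cong (_+ 1) (∑<-1 n)) (ℕ.+-comm n 1)

+-regroup : ∀ q Q a b c t → a + b ≡ c + t → (q + a) + (Q + b) ≡ (q + Q + c) + t
+-regroup q Q a b c t a+b≡c+t = begin
  (q + a) + (Q + b) ≡⟨ +-interchange q a Q b ⟩
  (q + Q) + (a + b) ≡⟨ cong (q + Q +_) a+b≡c+t ⟩
  (q + Q) + (c + t) ≡⟨ ℕ.+-assoc (q + Q) c t ⟨
  q + Q + c + t     ∎
  where open ≡-Reasoning

rotate : Fin 4 → Fin 4
rotate 0F = 1F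
rotate 1F = 2F
rotate 2F = 3F
rotate 3F = 0F

data Step : Set where
  short long : Step

advance : Step → Fin 4 → Fin 4
advance short c = rotate c
advance long  c = rotate (rotate c)

advance-arc : ∀ s c → H4Arc c (advance s c)
advance-arc short 0F = a01
advance-arc short 1F = a12
advance-arc short 2F = a23
advance-arc short 3F = a30
advance-arc long  0F = a02
advance-arc long  1F = a13
advance-arc long  2F = a20
advance-arc long  3F = a31

walk : (ℕ → Step) → Fin 4 → ℕ → Fin 4
walk steps c zero    = c
walk steps c (suc i) = advance (steps i) (walk steps c i)

walk-arc : ∀ steps c i → H4Arc (walk steps c i) (walk steps c (suc i))
walk-arc steps c i = advance-arc (steps i) (walk steps c i)

walk-cong : ∀ {steps steps′} → (∀ i → steps i ≡ steps′ i) → ∀ c n → walk steps c n ≡ walk steps′ c n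
walk-cong eq c zero    = refl
walk-cong eq c (suc n) = cong₂ advance (eq n) (walk-cong eq c n)

walk-+ : ∀ steps c m n → walk steps c (m + n) ≡ walk (λ i → steps (m + i)) (walk steps c m) n
walk-+ steps c m zero    = cong (walk steps c) (ℕ.+-identityʳ m)
walk-+ steps c m (suc n) rewrite ℕ.+-suc m n = cong (advance (steps (m + n))) (walk-+ steps c m n)

visits : (ℕ → Fin 4) → ℕ → Fin 4 → ℕ
visits w n d = ∑< n (λ i → δ (w i) d)

spin : Fin 4 → ℕ → Fin 4
spin = walk (λ _ → short)

spin-periodic : ∀ c i → spin c (4 + i) ≡ spin c i
spin-periodic c i = trans (walk-+ (λ _ → short) c 4 i) (cong (λ c′ → spin c′ i) (rotate⁴ c))
  where
  rotate⁴ : ∀ c → spin c 4 ≡ c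
  rotate⁴ 0F = refl
  rotate⁴ 1F = refl
  rotate⁴ 2F = refl
  rotate⁴ 3F = refl

spin-rounds : ∀ k c → spin c (k * 4) ≡ c
spin-rounds zero    c = refl
spin-rounds (suc k) c = trans (spin-periodic c (k * 4)) (spin-rounds k c)

spin-visits : ∀ k c d → visits (spin c) (k * 4) d ≡ k
spin-visits zero    c d = refl
spin-visits (suc k) c d = begin
  visits (spin c) (4 + k * 4) d
    ≡⟨ ∑<-+ 4 (k * 4) _ ⟩
  visits (spin c) 4 d + ∑< (k * 4) (λ i → δ (spin c (4 + i)) d)
    ≡⟨ cong₂ _+_ (one-round c d) (∑<-cong (k * 4) λ i _ → cong (λ c′ → δ c′ d) (spin-periodic c i)) ⟩
  1 + visits (spin c) (k * 4) d
    ≡⟨ cong suc (spin-visits k c d) ⟩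
  suc k
    ∎
  where
  open ≡-Reasoning
  one-round : ∀ c d → visits (spin c) 4 d ≡ 1
  one-round = from-yes (all? λ c → all? λ d → visits (spin c) 4 d ℕ.≟ 1)

excess : Fin 4 → Fin 4 → Fin 4 → ℕ
excess 0F p d = 0
excess 1F p d = δ p d
excess 2F p d = δ p d + δ (rotate (rotate p)) d
excess 3F p d = δ p d + δ (rotate p) d + δ (rotate (rotate p)) d

_⊕_ : Fin 4 → Fin 4 → Fin 4
r ⊕ s = (toℕ r + toℕ s) mod 4

carry : Fin 4 → Fin 4 → ℕ
carry r s = (toℕ r + toℕ s) / 4

⊕-carry : ∀ r s → toℕ r + toℕ s ≡ carry r s * 4 + toℕ (r ⊕ s)
⊕-carry r s = begin
  m                       ≡⟨ m≡m%n+[m/n]*n m 4 ⟩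
  m % 4 + m / 4 * 4       ≡⟨ cong (_+ m / 4 * 4) (toℕ-fromℕ< _) ⟨
  toℕ (r ⊕ s) + m / 4 * 4 ≡⟨ ℕ.+-comm (toℕ (r ⊕ s)) (carry r s * 4) ⟩
  carry r s * 4 + toℕ (r ⊕ s) ∎
  where
  open ≡-Reasoning
  m = toℕ r + toℕ s

-- Abstract, since later types would otherwise unfold the exhaustive search behind the witnesses.
abstract
  excess-merge : ∀ r s p → ∃₂ λ p′ p″ → ∀ d → excess r p d + excess s p′ d ≡ carry r s + excess (r ⊕ s) p″ d
  excess-merge = from-yes (all? λ r → all? λ s → all? λ p → any? λ p′ → any? λ p″ → all? λ d →
    excess r p d + excess s p′ d ℕ.≟ carry r s + excess (r ⊕ s) p″ d)

coreRounds : Fin 4 → ℕ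
coreRounds 0F = 1
coreRounds 1F = 1
coreRounds 2F = 0
coreRounds 3F = 0

coreLength : Fin 4 → ℕ
coreLength r = coreRounds r * 4 + toℕ r

-- For r = 0, 1, 2, 3 the core from p is the closed walk p p+1 p+2 p+3, p p+1 p+3 p p+2, p p+2 and
-- p p+1 p+2 respectively; after the core the walk keeps going round by +1 steps.
cycleSteps : Fin 4 → ℕ → Step
cycleSteps 1F 1 = long
cycleSteps 1F 3 = long
cycleSteps 1F 4 = long
cycleSteps 2F 0 = long
cycleSteps 2F 1 = long
cycleSteps 3F 2 = long
cycleSteps _  _ = short

cycleSteps-beyond-core : ∀ r i → cycleSteps r (coreLength r + i) ≡ short
cycleSteps-beyond-core 0F i = refl
cycleSteps-beyond-core 1F i = refl
cycleSteps-beyond-core 2F i = refl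
cycleSteps-beyond-core 3F i = refl

core-closed : ∀ r p → walk (cycleSteps r) p (coreLength r) ≡ p
core-closed = from-yes (all? λ r → all? λ p → walk (cycleSteps r) p (coreLength r) ≟ p)

core-visits : ∀ r p d → visits (walk (cycleSteps r) p) (coreLength r) d ≡ coreRounds r + excess r p d
core-visits = from-yes (all? λ r → all? λ p → all? λ d →
  visits (walk (cycleSteps r) p) (coreLength r) d ℕ.≟ coreRounds r + excess r p d)

cycleWalk-after-core : ∀ r p i → walk (cycleSteps r) p (coreLength r + i) ≡ spin p i
cycleWalk-after-core r p i = begin
  walk (cycleSteps r) p (coreLength r + i)
    ≡⟨ walk-+ (cycleSteps r) p (coreLength r) i ⟩
  walk (λ j → cycleSteps r (coreLength r + j)) (walk (cycleSteps r) p (coreLength r)) i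
    ≡⟨ walk-cong (cycleSteps-beyond-core r) _ i ⟩
  spin (walk (cycleSteps r) p (coreLength r)) i
    ≡⟨ cong (λ c → spin c i) (core-closed r p) ⟩
  spin p i
    ∎
  where open ≡-Reasoning

record CycleColourings (L : ℕ) : Set where
  field
    residue : Fin 4
    rounds  : ℕ
    length≡ : L ≡ rounds * 4 + toℕ residue
    colours : Fin 4 → ℕ → Fin 4
    arc     : ∀ p i → H4Arc (colours p i) (colours p (suc i))
    closed  : ∀ p → colours p L ≡ colours p 0
    visits≡ : ∀ p d → visits (colours p) L d ≡ rounds + excess residue p d

cycle-shape : ∀ m → ∃₂ λ r k → 2 + m ≡ coreLength r + k * 4
cycle-shape 0 = 2F , 0 , refl
cycle-shape 1 = 3F , 0 , refl
cycle-shape 2 = 0F , 0 , refl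
cycle-shape 3 = 1F , 0 , refl
cycle-shape (suc (suc (suc (suc m)))) with r , k , eq ← cycle-shape m =
  r , suc k , trans (cong (4 +_) eq) (+-left-comm 4 (coreLength r) (k * 4))

cycleColourings : ∀ L → 2 ≤ L → CycleColourings L
cycleColourings (suc (suc m)) (s≤s (s≤s _)) with r , k , L≡ ← cycle-shape m = record
  { residue = r
  ; rounds  = coreRounds r + k
  ; length≡ = trans L≡ (arith (coreRounds r) k (toℕ r))
  ; colours = walk (cycleSteps r)
  ; arc     = walk-arc (cycleSteps r)
  ; closed  = λ p → trans (cong (walk (cycleSteps r) p) L≡)
                          (trans (cycleWalk-after-core r p (k * 4)) (spin-rounds k p))
  ; visits≡ = λ p d → begin
      visits (walk (cycleSteps r) p) (2 + m) d
        ≡⟨ cong (λ n → visits (walk (cycleSteps r) p) n d) L≡ ⟩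
      visits (walk (cycleSteps r) p) (coreLength r + k * 4) d
        ≡⟨ ∑<-+ (coreLength r) (k * 4) _ ⟩
      visits (walk (cycleSteps r) p) (coreLength r) d
        + ∑< (k * 4) (λ i → δ (walk (cycleSteps r) p (coreLength r + i)) d)
        ≡⟨ cong₂ _+_ (core-visits r p d)
                     (trans (∑<-cong (k * 4) λ i _ → cong (λ c → δ c d) (cycleWalk-after-core r p i))
                            (spin-visits k p d)) ⟩
      (coreRounds r + excess r p d) + k
        ≡⟨ +-right-comm (coreRounds r) (excess r p d) k ⟩
      coreRounds r + k + excess r p d ∎
  }
  where
  open ≡-Reasoning
  arith : ∀ a k t → (a * 4 + t) + k * 4 ≡ (a + k) * 4 + t
  arith a k t = trans (+-right-comm (a * 4) t (k * 4)) (cong (_+ t) (sym (ℕ.*-distribʳ-+ 4 a k)))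

∑∈ : ∀ {N} → (Fin N → Bool) → (Fin N → ℕ) → ℕ
∑∈ {N} R g = ∑[ v < N ] (if R v then g v else 0)

∑∈-cong : ∀ {N} (R : Fin N → Bool) {g h : Fin N → ℕ} → (∀ v → R v ≡ true → g v ≡ h v) → ∑∈ R g ≡ ∑∈ R h
∑∈-cong R eq = sum-cong-≗ λ v → pointwise (R v) (eq v)
  where
  pointwise : ∀ b {x y} → (b ≡ true → x ≡ y) → (if b then x else 0) ≡ (if b then y else 0)
  pointwise true  eq = eq refl
  pointwise false eq = refl

∑∈-∨ : ∀ {N} (A B : Fin N → Bool) g → (∀ v → A v ≡ true → B v ≡ false) →
       ∑∈ (λ v → A v ∨ B v) g ≡ ∑∈ A g + ∑∈ B g
∑∈-∨ A B g disjoint = trans (sum-cong-≗ λ v → pointwise (A v) (B v) (g v) (disjoint v))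
  (∑-distrib-+ (λ v → if A v then g v else 0) (λ v → if B v then g v else 0))
  where
  pointwise : ∀ a b x → (a ≡ true → b ≡ false) →
              (if a ∨ b then x else 0) ≡ (if a then x else 0) + (if b then x else 0)
  pointwise true  b     x disj rewrite disj refl = sym (ℕ.+-identityʳ x)
  pointwise false b     x disj = refl

∑∈-∖ : ∀ {N} (R O : Fin N → Bool) g → (∀ v → O v ≡ true → R v ≡ true) →
       ∑∈ R g ≡ ∑∈ (λ v → R v ∧ not (O v)) g + ∑∈ O g
∑∈-∖ R O g O⊆R = trans (sum-cong-≗ λ v → pointwise (R v) (O v) (g v) (O⊆R v))
  (∑-distrib-+ (λ v → if R v ∧ not (O v) then g v else 0) (λ v → if O v then g v else 0))
  where
  pointwise : ∀ r o x → (o ≡ true → r ≡ true) →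
              (if r then x else 0) ≡ (if r ∧ not o then x else 0) + (if o then x else 0)
  pointwise true  true  x _ = refl
  pointwise true  false x _ = sym (ℕ.+-identityʳ x)
  pointwise false true  x ⊆ = contradiction (⊆ refl) λ ()
  pointwise false false x _ = refl

∑∈-point : ∀ {N} (a : Fin N) g → ∑∈ (λ v → does (a ≟ v)) g ≡ g a
∑∈-point {suc N} zero    g = trans (cong (g zero +_) (sum-replicate-zero N)) (ℕ.+-identityʳ (g zero))
∑∈-point {suc N} (suc a) g = ∑∈-point a (λ v → g (suc v))

Least : (ℕ → Set) → ℕ → Set
Least P k = P k × (∀ {j} → j < k → ¬ P j)

least : ∀ {P : ℕ → Set} → Decidable P → ∀ {n} → P n → ∃ (Least P)
least {P} P? {n} = <-rec (λ n → P n → ∃ (Least P)) step n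
  where
  step : ∀ n → (∀ {m} → m < n → P m → ∃ (Least P)) → P n → ∃ (Least P)
  step n smaller Pn with ℕ.anyUpTo? P? n
  ... | yes (m , m<n , Pm) = smaller m<n Pm
  ... | no none            = n , Pn , λ j<n Pj → none (_ , j<n , Pj)

module Orbits {N : ℕ} (σ : Fin N → Fin N) (σ-injective : Injective _≡_ _≡_ σ) where

  σ^ : ℕ → Fin N → Fin N
  σ^ zero    v = v
  σ^ (suc i) v = σ (σ^ i v)

  σ^-+ : ∀ m n v → σ^ (m + n) v ≡ σ^ m (σ^ n v)
  σ^-+ zero    n v = refl
  σ^-+ (suc m) n v = cong σ (σ^-+ m n v)

  σ^-injective : ∀ m {v w} → σ^ m v ≡ σ^ m w → v ≡ w
  σ^-injective zero    eq = eq
  σ^-injective (suc m) eq = σ^-injective m (σ-injective eq)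

  σ^-return : ∀ {i j} v → i ≤ j → σ^ i v ≡ σ^ j v → σ^ (j ∸ i) v ≡ v
  σ^-return {i} {j} v i≤j eq = sym (σ^-injective i (begin
    σ^ i v                 ≡⟨ eq ⟩
    σ^ j v                 ≡⟨ cong (λ k → σ^ k v) (ℕ.m+[n∸m]≡n i≤j) ⟨
    σ^ (i + (j ∸ i)) v     ≡⟨ σ^-+ i (j ∸ i) v ⟩
    σ^ i (σ^ (j ∸ i) v)    ∎))
    where open ≡-Reasoning

  σ-periodic : ∀ v → ∃ λ d → 0 < d × σ^ d v ≡ v
  σ-periodic v =
    let i , j , i<j , eq = pigeonhole (ℕ.n<1+n N) (λ k → σ^ (toℕ k) v)
    in toℕ j ∸ toℕ i , ℕ.m<n⇒0<n∸m i<j , σ^-return v (ℕ.<⇒≤ i<j) eq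

  record Cycle (u : Fin N) : Set where
    field
      period   : ℕ
      2≤period : 2 ≤ period
      returns  : σ^ period u ≡ u
      distinct : ∀ {i j} → i < period → j < period → σ^ i u ≡ σ^ j u → i ≡ j

    member : ℕ → Fin N → Bool
    member zero    v = false
    member (suc k) v = member k v ∨ does (σ^ k u ≟ v)

    position : ℕ → Fin N → ℕ
    position zero    v = 0
    position (suc k) v = if does (σ^ k u ≟ v) then k else position k v

    member-sound : ∀ k v → member k v ≡ true → ∃ λ i → i < k × σ^ i u ≡ v
    member-sound (suc k) v eq with member k v in earlier | σ^ k u ≟ v
    ... | true  | _     = let i , i<k , e = member-sound k v earlier in i , ℕ.m<n⇒m<1+n i<k , e
    ... | false | yes e = k , ℕ.n<1+n k , e
    ... | false | no _  = contradiction eq λ ()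

    member-complete : ∀ {i k} → i < k → member k (σ^ i u) ≡ true
    member-complete {i} {suc k} i<1+k with ℕ.m<1+n⇒m<n∨m≡n i<1+k
    ... | inj₁ i<k  rewrite member-complete i<k = refl
    ... | inj₂ refl rewrite dec-true (σ^ i u ≟ σ^ i u) refl = Bool.∨-zeroʳ _

    position-correct : ∀ {i k} → k ≤ period → i < k → position k (σ^ i u) ≡ i
    position-correct {i} {suc k} k<period i<1+k with σ^ k u ≟ σ^ i u
    ... | yes eq = distinct k<period (ℕ.<-≤-trans i<1+k k<period) eq
    ... | no neq with ℕ.m<1+n⇒m<n∨m≡n i<1+k
    ...   | inj₁ i<k  = position-correct (ℕ.<⇒≤ k<period) i<k
    ...   | inj₂ refl = contradiction refl neq

    member-fresh : ∀ {k} v → k < period → member k v ≡ true → does (σ^ k u ≟ v) ≡ false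
    member-fresh {k} v k<period v∈ with i , i<k , eq ← member-sound k v v∈ =
      dec-false (σ^ k u ≟ v) λ eq′ →
        ℕ.<-irrefl (distinct (ℕ.<-trans i<k k<period) k<period (trans eq (sym eq′))) i<k

    ∑∈-member : ∀ k → k ≤ period → ∀ g → ∑∈ (member k) g ≡ ∑< k (λ i → g (σ^ i u))
    ∑∈-member zero    _          g = sum-replicate-zero N
    ∑∈-member (suc k) k<period g = begin
      ∑∈ (member (suc k)) g
        ≡⟨ ∑∈-∨ (member k) (λ v → does (σ^ k u ≟ v)) g (λ v → member-fresh v k<period) ⟩
      ∑∈ (member k) g + ∑∈ (λ v → does (σ^ k u ≟ v)) g
        ≡⟨ cong₂ _+_ (∑∈-member k (ℕ.<⇒≤ k<period) g) (∑∈-point (σ^ k u) g) ⟩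
      ∑< k (λ i → g (σ^ i u)) + g (σ^ k u)
        ∎
      where open ≡-Reasoning

    σ-last : ∃ λ j → j < period × σ (σ^ j u) ≡ u
    σ-last = wrap period 2≤period returns
      where
      wrap : ∀ L → 2 ≤ L → σ^ L u ≡ u → ∃ λ j → j < L × σ (σ^ j u) ≡ u
      wrap (suc j) _ ret = j , ℕ.n<1+n j , ret

    member-σ⁻¹ : ∀ v → member period (σ v) ≡ true → member period v ≡ true
    member-σ⁻¹ v σv∈ with member-sound period (σ v) σv∈
    ... | suc i , i+1<period , eq =
      subst (λ w → member period w ≡ true) (σ-injective eq)
            (member-complete (ℕ.<-trans (ℕ.n<1+n i) i+1<period))
    ... | zero  , _          , eq with j , j<period , σ^j+1≡u ← σ-last =
      subst (λ w → member period w ≡ true) (σ-injective (trans σ^j+1≡u eq)) (member-complete j<period)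

    paint : {A : Set} → (ℕ → A) → (Fin N → A) → Fin N → A
    paint w ψ v = if member period v then w (position period v) else ψ v

    paint-orbit : ∀ {A : Set} (w : ℕ → A) ψ {i} → i < period → paint w ψ (σ^ i u) ≡ w i
    paint-orbit w ψ {i} i<period = trans
      (cong (λ b → if b then w (position period (σ^ i u)) else ψ (σ^ i u)) (member-complete i<period))
      (cong w (position-correct ℕ.≤-refl i<period))

    paint-outside : ∀ {A : Set} (w : ℕ → A) ψ {v} → member period v ≡ false → paint w ψ v ≡ ψ v
    paint-outside w ψ {v} v∉ = cong (λ b → if b then w (position period v) else ψ v) v∉

    paint-arc : ∀ {A : Set} (E : A → A → Set) (w : ℕ → A) ψ → (∀ i → E (w i) (w (suc i))) → w period ≡ w 0 →
                ∀ v → member period v ≡ true → E (paint w ψ v) (paint w ψ (σ v))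
    paint-arc E w ψ w-arc w-closed v v∈ with i , i<period , refl ← member-sound period v v∈ =
      subst₂ E (sym (paint-orbit w ψ i<period)) (sym paint-next) (w-arc i)
      where
      paint-next : paint w ψ (σ^ (suc i) u) ≡ w (suc i)
      paint-next with ℕ.m≤n⇒m<n∨m≡n i<period
      ... | inj₁ i+1<period = paint-orbit w ψ i+1<period
      ... | inj₂ i+1≡period = begin
        paint w ψ (σ^ (suc i) u)  ≡⟨ cong (λ k → paint w ψ (σ^ k u)) i+1≡period ⟩
        paint w ψ (σ^ period u)   ≡⟨ cong (paint w ψ) returns ⟩
        paint w ψ u               ≡⟨ paint-orbit w ψ (ℕ.<-trans (ℕ.n<1+n 0) 2≤period) ⟩
        w 0                       ≡⟨ w-closed ⟨
        w period                  ≡⟨ cong w i+1≡period ⟨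
        w (suc i)                 ∎
        where open ≡-Reasoning

  cycle : (∀ v → σ v ≢ v) → ∀ u → Cycle u
  cycle fixpoint-free u with σ-periodic u
  ... | suc d , _ , σ^d+1≡u with k , σ^k+1≡u , minimal ← least (λ k → σ^ (suc k) u ≟ u) {d} σ^d+1≡u = record
    { period   = suc k
    ; 2≤period = nontrivial k σ^k+1≡u
    ; returns  = σ^k+1≡u
    ; distinct = distinct
    }
    where
    nontrivial : ∀ k → σ^ (suc k) u ≡ u → 2 ≤ suc k
    nontrivial zero    σu≡u = contradiction σu≡u (fixpoint-free u)
    nontrivial (suc k) _    = s≤s (s≤s z≤n)

    no-early-return : ∀ {e} → 0 < e → e < suc k → σ^ e u ≢ u
    no-early-return {suc e} _ (s≤s e<k) = minimal e<k

    distinct : ∀ {i j} → i < suc k → j < suc k → σ^ i u ≡ σ^ j u → i ≡ j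
    distinct {i} {j} i<period j<period eq with ℕ.<-cmp i j
    ... | tri< i<j _ _ = contradiction (σ^-return u (ℕ.<⇒≤ i<j) eq)
                           (no-early-return (ℕ.m<n⇒0<n∸m i<j) (ℕ.≤-<-trans (ℕ.m∸n≤m j i) j<period))
    ... | tri≈ _ i≡j _ = i≡j
    ... | tri> _ _ j<i = contradiction (σ^-return u (ℕ.<⇒≤ j<i) (sym eq))
                           (no-early-return (ℕ.m<n⇒0<n∸m j<i) (ℕ.≤-<-trans (ℕ.m∸n≤m i j) i<period))

module NearlyBalancedColourings {N : ℕ} (σ : Fin N → Fin N) (σ-injective : Injective _≡_ _≡_ σ)
                                (fixpoint-free : ∀ v → σ v ≢ v) where
  open Orbits σ σ-injective

  Closed : (Fin N → Bool) → Set
  Closed R = ∀ v → R v ≡ true → R (σ v) ≡ true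

  size : (Fin N → Bool) → ℕ
  size R = ∑∈ R (λ _ → 1)

  record NearlyBalanced (R : Fin N → Bool) : Set where
    field
      colour     : Fin N → Fin 4
      colour-arc : ∀ v → R v ≡ true → H4Arc (colour v) (colour (σ v))
      rounds     : ℕ
      residue    : Fin 4
      anchor     : Fin 4
      size≡      : size R ≡ rounds * 4 + toℕ residue
      classes≡   : ∀ d → ∑∈ R (λ v → δ (colour v) d) ≡ rounds + excess residue anchor d

  nearlyBalanced-∅ : ∀ R → (∀ v → R v ≢ true) → NearlyBalanced R
  nearlyBalanced-∅ R R-empty = record
    { colour     = λ _ → 0F
    ; colour-arc = λ v v∈R → contradiction v∈R (R-empty v)
    ; rounds     = 0
    ; residue    = 0F
    ; anchor     = 0F
    ; size≡      = ∑∈-∅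
    ; classes≡   = λ d → ∑∈-∅
    }
    where
    ∑∈-∅ : ∀ {g} → ∑∈ R g ≡ 0
    ∑∈-∅ {g} = trans (sum-cong-≗ λ v → cong (λ b → if b then g v else 0) (Bool.¬-not (R-empty v)))
                     (sum-replicate-zero N)

  module WithoutCycle (R : Fin N → Bool) (R-closed : Closed R) (u : Fin N) (u∈R : R u ≡ true) where
    open Cycle (cycle fixpoint-free u)

    orbit : Fin N → Bool
    orbit = member period

    rest : Fin N → Bool
    rest v = R v ∧ not (orbit v)

    orbit⊆R : ∀ v → orbit v ≡ true → R v ≡ true
    orbit⊆R v v∈ with i , _ , refl ← member-sound period v v∈ = iterate-in-R i
      where
      iterate-in-R : ∀ i → R (σ^ i u) ≡ true
      iterate-in-R zero    = u∈R
      iterate-in-R (suc i) = R-closed _ (iterate-in-R i)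

    outside-σ : ∀ v → orbit v ≡ false → orbit (σ v) ≡ false
    outside-σ v v∉ = Bool.¬-not λ σv∈ → contradiction (trans (sym v∉) (member-σ⁻¹ v σv∈)) λ ()

    rest⇒outside : ∀ v → rest v ≡ true → orbit v ≡ false
    rest⇒outside v v∈ = Bool.not-injective (Bool.∧-conicalʳ (R v) (not (orbit v)) v∈)

    rest-closed : Closed rest
    rest-closed v v∈ = cong₂ (λ a b → a ∧ not b)
      (R-closed v (Bool.∧-conicalˡ (R v) (not (orbit v)) v∈)) (outside-σ v (rest⇒outside v v∈))

    ∑∈-R : ∀ g → ∑∈ R g ≡ ∑∈ rest g + ∑< period (λ i → g (σ^ i u))
    ∑∈-R g = trans (∑∈-∖ R orbit g orbit⊆R) (cong (∑∈ rest g +_) (∑∈-member period ℕ.≤-refl g))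

    size-R : size R ≡ size rest + period
    size-R = trans (∑∈-R (λ _ → 1)) (cong (size rest +_) (∑<-1 period))

    size-rest<size-R : size rest < size R
    size-rest<size-R =
      subst (size rest <_) (sym size-R) (ℕ.m<m+n (size rest) (ℕ.<-trans (ℕ.n<1+n 0) 2≤period))

    extend : NearlyBalanced rest → NearlyBalanced R
    extend nb = record
      { colour     = colour
      ; colour-arc = colour-arc
      ; rounds     = q + Q + carry r s
      ; residue    = r ⊕ s
      ; anchor     = p″
      ; size≡      = size≡
      ; classes≡   = classes≡
      }
      where
      open NearlyBalanced nb using () renaming
        (colour to colour₀; colour-arc to colour₀-arc; rounds to q; residue to r; anchor to p;
         size≡ to size₀≡; classes≡ to classes₀≡)
      open CycleColourings (cycleColourings period 2≤period) renaming (residue to s; rounds to Q)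

      merge = excess-merge r s p
      p′ = proj₁ merge
      p″ = proj₁ (proj₂ merge)
      merged = proj₂ (proj₂ merge)
      w  = colours p′

      colour : Fin N → Fin 4
      colour = paint w colour₀

      colour-arc : ∀ v → R v ≡ true → H4Arc (colour v) (colour (σ v))
      colour-arc v v∈R = by-orbit (orbit v) refl
        where
        by-orbit : ∀ b → orbit v ≡ b → H4Arc (colour v) (colour (σ v))
        by-orbit true  v∈ = paint-arc H4Arc w colour₀ (arc p′) (closed p′) v v∈
        by-orbit false v∉ =
          subst₂ H4Arc (sym (paint-outside w colour₀ v∉)) (sym (paint-outside w colour₀ (outside-σ v v∉)))
                 (colour₀-arc v (cong₂ (λ a b → a ∧ not b) v∈R v∉))

      open ≡-Reasoning

      size≡ : size R ≡ (q + Q + carry r s) * 4 + toℕ (r ⊕ s)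
      size≡ = begin
        size R
          ≡⟨ size-R ⟩
        size rest + period
          ≡⟨ cong₂ _+_ size₀≡ length≡ ⟩
        (q * 4 + toℕ r) + (Q * 4 + toℕ s)
          ≡⟨ +-regroup (q * 4) (Q * 4) (toℕ r) (toℕ s) (carry r s * 4) (toℕ (r ⊕ s)) (⊕-carry r s) ⟩
        q * 4 + Q * 4 + carry r s * 4 + toℕ (r ⊕ s)
          ≡⟨ cong (_+ toℕ (r ⊕ s)) distrib ⟨
        (q + Q + carry r s) * 4 + toℕ (r ⊕ s)
          ∎
        where
        distrib : (q + Q + carry r s) * 4 ≡ q * 4 + Q * 4 + carry r s * 4
        distrib = trans (ℕ.*-distribʳ-+ 4 (q + Q) (carry r s))
                        (cong (_+ carry r s * 4) (ℕ.*-distribʳ-+ 4 q Q))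

      classes≡ : ∀ d → ∑∈ R (λ v → δ (colour v) d) ≡ q + Q + carry r s + excess (r ⊕ s) p″ d
      classes≡ d = begin
        ∑∈ R (λ v → δ (colour v) d)
          ≡⟨ ∑∈-R (λ v → δ (colour v) d) ⟩
        ∑∈ rest (λ v → δ (colour v) d) + ∑< period (λ i → δ (colour (σ^ i u)) d)
          ≡⟨ cong₂ _+_
               (∑∈-cong rest λ v v∈ → cong (λ c → δ c d) (paint-outside w colour₀ (rest⇒outside v v∈)))
               (∑<-cong period λ i i<period → cong (λ c → δ c d) (paint-orbit w colour₀ i<period)) ⟩
        ∑∈ rest (λ v → δ (colour₀ v) d) + visits w period d
          ≡⟨ cong₂ _+_ (classes₀≡ d) (visits≡ p′ d) ⟩
        (q + excess r p d) + (Q + excess s p′ d)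
          ≡⟨ +-regroup q Q (excess r p d) (excess s p′ d) (carry r s) (excess (r ⊕ s) p″ d) (merged d) ⟩
        q + Q + carry r s + excess (r ⊕ s) p″ d
          ∎

  nearlyBalanced : ∀ R → Closed R → NearlyBalanced R
  nearlyBalanced R = go R (<-wellFounded (size R))
    where
    go : ∀ R → Acc _<_ (size R) → Closed R → NearlyBalanced R
    go R (acc smaller) R-closed with any? (λ v → R v Bool.≟ true)
    ... | no  R-empty   = nearlyBalanced-∅ R (λ v v∈R → R-empty (v , v∈R))
    ... | yes (u , u∈R) = extend (go rest (smaller size-rest<size-R) rest-closed)
      where open WithoutCycle R R-closed u u∈R

length-filter-tabulate : ∀ {n} {A : Set} {P : A → Set} (P? : Decidable P) (f : Fin n → A) →
                         length (filter P? (tabulate f)) ≡ ∑[ i < n ] 𝟙 (does (P? (f i)))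
length-filter-tabulate {zero}  P? f = refl
length-filter-tabulate {suc n} P? f with does (P? (f zero))
... | true  = cong suc (length-filter-tabulate P? (λ i → f (suc i)))
... | false = length-filter-tabulate P? (λ i → f (suc i))

∑-ones : ∀ n → ∑[ i < n ] 1 ≡ n
∑-ones zero    = refl
∑-ones (suc n) = cong suc (∑-ones n)

multiple-remainder : ∀ {d} .{{_ : NonZero d}} m q {r} → r < d → m * d ≡ q * d + r → r ≡ 0
multiple-remainder {d} m q {r} r<d m*d≡q*d+r = begin
  r               ≡⟨ m<n⇒m%n≡m r<d ⟨
  r % d           ≡⟨ [m+kn]%n≡m%n r q d ⟨
  (r + q * d) % d ≡⟨ cong (_% d) (trans (ℕ.+-comm r (q * d)) (sym m*d≡q*d+r)) ⟩
  (m * d) % d     ≡⟨ m*n%n≡0 m d ⟩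
  0               ∎
  where open ≡-Reasoning

lemma18 : (n : ℕ) → n ≥ 1 → (G : Digraph (4 * n)) → IsUnionOfCycles≥2 G →
    Σ (Fin (4 * n) → Fin 4) λ φ → IsH4Coloring G φ × IsBalanced φ
lemma18 n _ G (π , fixpoint-free , arcs⇔) = colour , colour-H4 , balanced
  where
  open NearlyBalancedColourings (π ⟨$⟩ʳ_) (Injection.injective (↔⇒↣ π)) fixpoint-free
  open NearlyBalanced (nearlyBalanced (λ _ → true) (λ _ _ → refl))
  open ≡-Reasoning

  colour-H4 : IsH4Coloring G colour
  colour-H4 u v uv =
    subst (λ w → H4Arc (colour u) (colour w)) (sym (Equivalence.to (arcs⇔ u v) uv)) (colour-arc u refl)

  residue≡0F : residue ≡ 0F
  residue≡0F = toℕ-injective (multiple-remainder n rounds (toℕ<n residue) (begin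
    n * 4                        ≡⟨ ℕ.*-comm n 4 ⟩
    4 * n                        ≡⟨ ∑-ones (4 * n) ⟨
    size (λ _ → true)            ≡⟨ size≡ ⟩
    rounds * 4 + toℕ residue     ∎))

  classSize≡rounds : ∀ c → classSize colour c ≡ rounds
  classSize≡rounds c = begin
    classSize colour c                  ≡⟨ length-filter-tabulate (λ v → colour v ≟ c) id ⟩
    ∑[ v < 4 * n ] δ (colour v) c       ≡⟨ classes≡ c ⟩
    rounds + excess residue anchor c    ≡⟨ cong (λ r → rounds + excess r anchor c) residue≡0F ⟩
    rounds + 0                          ≡⟨ ℕ.+-identityʳ rounds ⟩
    rounds                              ∎

  balanced : IsBalanced colour
  balanced c d = trans (classSize≡rounds c) (sym (classSize≡rounds d))
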